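{- Let $G$ be a graph with $n$ vertices and $m$ edges. If the line graph $L(G)$ has an odd cycle transversal of size at most $m-n$, then $G$ has an even cycle factor.
   Context: All graphs are finite and simple. The line graph $L(G)$ of a graph $G=(V,E)$ has vertex set $E$, two vertices $e_1,e_2$ of $L(G)$ being adjacent if and only if the edges $e_1$ and $e_2$ share an end-vertex in $G$. An odd cycle transversal of a graph $H$ is a set $S\subseteq V(H)$ such that $H-S$ is bipartite (contains no odd cycle). A 2-factor of $G$ is a set of cycles of $G$ such that every vertex of $G$ belongs to exactly one of them; an even cycle factor is a 2-factor in which every cycle has even length. -}

module Defs where

open import Data.Nat using (ℕ; zero; suc; _+_; _≤_)
open import Data.Nat.Divisibility using (_∣_)
open import Data.Fin using (Fin; zero; suc; inject₁; fromℕ)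
open import Data.Fin.Subset using (Subset; _∈_; _∉_; ∣_∣)
open import Data.Bool using (Bool)
open import Data.List using (List; length; lookup)
open import Data.Product using (Σ; ∃; ∃-syntax; _×_; _,_; proj₁; proj₂)
open import Data.Sum using (_⊎_)
open import Relation.Binary.PropositionalEquality using (_≡_; _≢_)
open import Function.Definitions using (Injective)

SamePair : ∀ {n} → Fin n × Fin n → Fin n × Fin n → Set
SamePair (a , b) (c , d) = (a ≡ c × b ≡ d) ⊎ (a ≡ d × b ≡ c)

record Graph (n m : ℕ) : Set where
  field
    edge     : Fin m → Fin n × Fin n
    loopless : ∀ e → proj₁ (edge e) ≢ proj₂ (edge e)
    simple   : ∀ e f → SamePair (edge e) (edge f) → e ≡ f
open Graph public

Adj : ∀ {n m} → Graph n m → Fin n → Fin n → Set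
Adj {m = m} G u v = ∃[ e ] SamePair (edge G e) (u , v)

Incident : ∀ {n m} → Graph n m → Fin n → Fin m → Set
Incident G v e = (proj₁ (edge G e) ≡ v) ⊎ (proj₂ (edge G e) ≡ v)

LineAdj : ∀ {n m} → Graph n m → Fin m → Fin m → Set
LineAdj {n} G e f = e ≢ f × ∃[ v ] (Incident G v e × Incident G v f)

-- S is an odd cycle transversal of L(G): L(G) - S is bipartite,
-- i.e. admits a proper 2-colouring.
IsOCT : ∀ {n m} → Graph n m → Subset m → Set
IsOCT {m = m} G S =
  Σ (Fin m → Bool) λ c →
    ∀ e f → e ∉ S → f ∉ S → LineAdj G e f → c e ≢ c f

-- A cycle of G of length suc k ≥ 3: distinct vertices v₀,…,v_k with
-- v_i v_{i+1} and v_k v₀ edges.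
record Cycle {n m} (G : Graph n m) : Set where
  field
    k     : ℕ
    long  : 2 ≤ k
    vert  : Fin (suc k) → Fin n
    inj   : Injective _≡_ _≡_ vert
    step  : ∀ (i : Fin k) → Adj G (vert (inject₁ i)) (vert (suc i))
    close : Adj G (vert (fromℕ k)) (vert zero)
open Cycle public

length-of : ∀ {n m} {G : Graph n m} → Cycle G → ℕ
length-of C = suc (k C)

OnCycle : ∀ {n m} {G : Graph n m} → Fin n → Cycle G → Set
OnCycle v C = ∃[ i ] vert C i ≡ v

Is2Factor : ∀ {n m} (G : Graph n m) → List (Cycle G) → Set
Is2Factor {n} G cs =
  ∀ (v : Fin n) →
    (∃[ i ] OnCycle v (lookup cs i)) ×
    (∀ i j → OnCycle v (lookup cs i) → OnCycle v (lookup cs j) → i ≡ j)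

HasEvenCycleFactor : ∀ {n m} → Graph n m → Set
HasEvenCycleFactor G =
  ∃[ cs ] (Is2Factor G cs × (∀ i → 2 ∣ length-of (lookup cs i)))

-- Colour the edges outside S by a proper 2-colouring of L(G) - S. Two edges of
-- the same colour never share a vertex, so each vertex meets at most one outside
-- edge of each colour; as there are at least n outside edges, and hence at least
-- 2n endpoint incidences, every vertex meets exactly one outside edge of each
-- colour. The two colour classes are therefore disjoint perfect matchings, and
-- following them alternately from a vertex closes up into a cycle of even length.
-- These cycles partition the vertices.

module Submission where

open import Defs
open import Data.Nat.Properties hiding (_≟_)
open import Algebra.Properties.CommutativeMonoid.Sum +-0-commutativeMonoid
  using (sum; sum-syntax; ∑-distrib-+; ∑-comm; sum-cong-≗; sum-replicate-zero)
open import Data.Bool using (Bool; true; false; not; if_then_else_)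
open import Data.Bool.Properties using (not-involutive; ¬-not) renaming (_≟_ to _≟ᵇ_)
open import Data.Empty using (⊥-elim)
open import Data.Fin using (Fin; zero; suc; toℕ; fromℕ<; _≟_)
import Data.Fin.Properties as Finₚ
open import Data.Fin.Subset using (Subset; ∣_∣; _∉_)
open import Data.Fin.Subset.Properties using (_∈?_)
open import Data.List using (List; map; filter; allFin; lookup)
open import Data.List.Membership.Propositional using (_∈_)
open import Data.List.Membership.Propositional.Properties
  using (∈-map⁺; ∈-map⁻; ∈-filter⁺; ∈-filter⁻; ∈-lookup; ∈-allFin)
import Data.List.Relation.Unary.All as All
open import Data.List.Relation.Unary.AllPairs using (_∷_)
open import Data.List.Relation.Unary.Any using (index)
open import Data.List.Relation.Unary.Any.Properties using (lookup-index)
open import Data.List.Relation.Unary.Unique.Propositional using (Unique)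
import Data.List.Relation.Unary.Unique.Propositional.Properties as Uniqueₚ
open import Data.Nat using (ℕ; zero; suc; _+_; _*_; _∸_; _≤_; _<_; z≤n; s≤s)
open import Data.Nat.Divisibility using (_∣_; divides)
open import Data.Product using (∃; ∃-syntax; _×_; _,_; proj₁; proj₂)
open import Data.Sum using (_⊎_; inj₁; inj₂)
import Data.Sum as Sum
open import Data.Vec using ([]; _∷_)
open import Function using (case_of_)
open import Relation.Binary.Definitions using (tri<; tri≈; tri>)
open import Relation.Binary.PropositionalEquality
open import Relation.Nullary using (¬_; Dec; does; yes; no; ¬?; _×-dec_; _⊎-dec_; map′)
open import Relation.Unary using (Pred; Decidable)

-- Through does rather than yes/no patterns, so that it computes on decisions built
-- with map′, such as _∈?_ on subsets and _≟_ on Fin.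
indicator : ∀ {a} {A : Set a} → Dec A → ℕ
indicator a? = if does a? then 1 else 0

count : ∀ {k p} {P : Pred (Fin k) p} → Decidable P → ℕ
count {k} P? = ∑[ i < k ] indicator (P? i)

∑-const : ∀ k c → ∑[ i < k ] c ≡ k * c
∑-const zero    c = refl
∑-const (suc k) c = cong (c +_) (∑-const k c)

∑-mono-≤ : ∀ {k} {f g : Fin k → ℕ} → (∀ i → f i ≤ g i) → sum f ≤ sum g
∑-mono-≤ {zero}  f≤g = z≤n
∑-mono-≤ {suc k} f≤g = +-mono-≤ (f≤g zero) (∑-mono-≤ (λ i → f≤g (suc i)))

∑-mono-≤-tight : ∀ {k} {f g : Fin k → ℕ} → (∀ i → f i ≤ g i) → sum g ≤ sum f → ∀ i → g i ≤ f i
∑-mono-≤-tight {suc k} {f} {g} f≤g ∑g≤∑f zero =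
  +-cancelʳ-≤ (sum (λ i → g (suc i))) (g zero) (f zero)
    (≤-trans ∑g≤∑f (+-monoʳ-≤ (f zero) (∑-mono-≤ (λ i → f≤g (suc i)))))
∑-mono-≤-tight {suc k} {f} {g} f≤g ∑g≤∑f (suc i) =
  ∑-mono-≤-tight (λ j → f≤g (suc j))
    (+-cancelˡ-≤ (g zero) _ _ (≤-trans ∑g≤∑f (+-monoˡ-≤ _ (f≤g zero))))
  i

count≤1 : ∀ {k p} {P : Pred (Fin k) p} (P? : Decidable P) →
          (∀ {i j} → P i → P j → i ≡ j) → count P? ≤ 1
count≤1 {zero}  P? unique = z≤n
count≤1 {suc k} P? unique with P? zero
... | yes P0 = s≤s (≤-trans (∑-mono-≤ absent) (≤-reflexive (sum-replicate-zero k)))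
  where
  absent : ∀ i → indicator (P? (suc i)) ≤ 0
  absent i with P? (suc i)
  ... | yes Pi with () ← unique P0 Pi
  ... | no _ = z≤n
... | no _ = count≤1 (λ i → P? (suc i)) (λ Pi Pj → Finₚ.suc-injective (unique Pi Pj))

count-witness : ∀ {k p} {P : Pred (Fin k) p} (P? : Decidable P) → 1 ≤ count P? → ∃ P
count-witness {suc k} P? pos with P? zero
... | yes P0 = zero , P0
... | no _ with i , Pi ← count-witness (λ i → P? (suc i)) pos = suc i , Pi

count-≡ : ∀ {k} (a : Fin k) → count (a ≟_) ≡ 1
count-≡ {suc k} zero    = cong suc (sum-replicate-zero k)
count-≡ {suc k} (suc a) = count-≡ a

indicator-⊎ : ∀ {a b} {A : Set a} {B : Set b} (a? : Dec A) (b? : Dec B) →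
              ¬ (A × B) → indicator (a? ⊎-dec b?) ≡ indicator a? + indicator b?
indicator-⊎ (yes a) (yes b) ¬a×b = ⊥-elim (¬a×b (a , b))
indicator-⊎ (yes _) (no _)  _    = refl
indicator-⊎ (no _)  _       _    = refl

count-∉ : ∀ {m} (S : Subset m) → count (λ e → ¬? (e ∈? S)) + ∣ S ∣ ≡ m
count-∉ []          = refl
count-∉ (true ∷ S)  = trans (+-suc _ ∣ S ∣) (cong suc (count-∉ S))
count-∉ (false ∷ S) = cong suc (count-∉ S)

indicator-by-colour : ∀ {a b} {A : Set a} {B : Set b} (a? : Dec A) (x : Bool) (b? : Dec B) →
  indicator ((a? ×-dec x ≟ᵇ true) ×-dec b?) + indicator ((a? ×-dec x ≟ᵇ false) ×-dec b?)
    ≡ indicator (a? ×-dec b?)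
indicator-by-colour (yes _) true  (yes _) = refl
indicator-by-colour (yes _) true  (no _)  = refl
indicator-by-colour (yes _) false (yes _) = refl
indicator-by-colour (yes _) false (no _)  = refl
indicator-by-colour (no _)  _     _       = refl

∃⟶∃-least : ∀ {k p} {P : Pred (Fin k) p} → Decidable P → ∃ P →
            ∃[ u ] P u × (∀ {y} → P y → toℕ u ≤ toℕ y)
∃⟶∃-least {suc k} P? (a , Pa) with P? zero
... | yes P0 = zero , P0 , λ _ → z≤n
∃⟶∃-least {suc k} P? (zero  , P0) | no ¬P0 = ⊥-elim (¬P0 P0)
∃⟶∃-least {suc k} P? (suc a , Pa) | no ¬P0
  with u , Pu , least ← ∃⟶∃-least (λ i → P? (suc i)) (a , Pa)
  = suc u , Pu , λ { {zero} P0 → ⊥-elim (¬P0 P0) ; {suc y} Py → s≤s (least Py) }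

even⊎odd : ∀ k → ∃[ d ] (k ≡ d * 2 ⊎ k ≡ suc (d * 2))
even⊎odd zero          = 0 , inj₁ refl
even⊎odd (suc zero)    = 0 , inj₂ refl
even⊎odd (suc (suc k)) with d , k≡ ← even⊎odd k = suc d , Sum.map (cong (2 +_)) (cong (2 +_)) k≡

Unique⇒lookup-injective : ∀ {a} {A : Set a} {xs : List A} → Unique xs →
                          ∀ i j → lookup xs i ≡ lookup xs j → i ≡ j
Unique⇒lookup-injective (_     ∷ _) zero    zero    _  = refl
Unique⇒lookup-injective (x∉xs ∷ _) zero    (suc j) eq = ⊥-elim (All.lookup x∉xs (∈-lookup j) eq)
Unique⇒lookup-injective (x∉xs ∷ _) (suc i) zero    eq = ⊥-elim (All.lookup x∉xs (∈-lookup i) (sym eq))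
Unique⇒lookup-injective (_     ∷ u) (suc i) (suc j) eq = cong suc (Unique⇒lookup-injective u i j eq)

module _ {n} {a b c d : Fin n} where

  SamePair-sym : SamePair (a , b) (c , d) → SamePair (c , d) (a , b)
  SamePair-sym (inj₁ (a≡c , b≡d)) = inj₁ (sym a≡c , sym b≡d)
  SamePair-sym (inj₂ (a≡d , b≡c)) = inj₂ (sym b≡c , sym a≡d)

  SamePair-swapʳ : SamePair (a , b) (c , d) → SamePair (a , b) (d , c)
  SamePair-swapʳ (inj₁ eqs) = inj₂ eqs
  SamePair-swapʳ (inj₂ eqs) = inj₁ eqs

  SamePair-trans : ∀ {x y : Fin n} →
                   SamePair (a , b) (c , d) → SamePair (c , d) (x , y) → SamePair (a , b) (x , y)
  SamePair-trans (inj₁ (p , q)) (inj₁ (r , s)) = inj₁ (trans p r , trans q s)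
  SamePair-trans (inj₁ (p , q)) (inj₂ (r , s)) = inj₂ (trans p r , trans q s)
  SamePair-trans (inj₂ (p , q)) (inj₁ (r , s)) = inj₂ (trans p s , trans q r)
  SamePair-trans (inj₂ (p , q)) (inj₂ (r , s)) = inj₁ (trans p s , trans q r)

  SamePair-injectiveʳ : SamePair (a , b) (c , d) → ∀ {x} → SamePair (a , b) (c , x) → d ≡ x
  SamePair-injectiveʳ (inj₁ (p , q)) (inj₁ (r , s)) = trans (sym q) s
  SamePair-injectiveʳ (inj₁ (p , q)) (inj₂ (r , s)) = trans (sym q) (trans s (trans (sym p) r))
  SamePair-injectiveʳ (inj₂ (p , q)) (inj₁ (r , s)) = trans (sym p) (trans r (trans (sym q) s))
  SamePair-injectiveʳ (inj₂ (p , q)) (inj₂ (r , s)) = trans (sym p) r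

SamePair-diagonal : ∀ {n} {a b c : Fin n} → SamePair (a , b) (c , c) → a ≡ b
SamePair-diagonal (inj₁ (p , q)) = trans p (sym q)
SamePair-diagonal (inj₂ (p , q)) = trans p (sym q)

module _ {n m} (G : Graph n m) where

  incident? : ∀ e → Decidable (λ v → Incident G v e)
  incident? e v = (proj₁ (edge G e) ≟ v) ⊎-dec (proj₂ (edge G e) ≟ v)

  count-incident : ∀ e → count (incident? e) ≡ 2
  count-incident e = begin
    count (incident? e)
      ≡⟨ sum-cong-≗ (λ v → indicator-⊎ (a ≟ v) (b ≟ v) λ (a≡v , b≡v) → loopless G e (trans a≡v (sym b≡v))) ⟩
    ∑[ v < n ] (indicator (a ≟ v) + indicator (b ≟ v))
      ≡⟨ ∑-distrib-+ (λ v → indicator (a ≟ v)) (λ v → indicator (b ≟ v)) ⟩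
    count (a ≟_) + count (b ≟_)
      ≡⟨ cong₂ _+_ (count-≡ a) (count-≡ b) ⟩
    2 ∎
    where
    open ≡-Reasoning
    a = proj₁ (edge G e)
    b = proj₂ (edge G e)

  handshake : ∀ {p} {Q : Pred (Fin m) p} (Q? : Decidable Q) →
              ∑[ v < n ] count (λ e → Q? e ×-dec incident? e v) ≡ count Q? + count Q?
  handshake Q? = begin
    ∑[ v < n ] ∑[ e < m ] indicator (Q? e ×-dec incident? e v)
      ≡⟨ ∑-comm (λ v e → indicator (Q? e ×-dec incident? e v)) ⟩
    ∑[ e < m ] ∑[ v < n ] indicator (Q? e ×-dec incident? e v)
      ≡⟨ sum-cong-≗ degree-of-edge ⟩
    ∑[ e < m ] (indicator (Q? e) + indicator (Q? e))
      ≡⟨ ∑-distrib-+ (λ e → indicator (Q? e)) (λ e → indicator (Q? e)) ⟩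
    count Q? + count Q? ∎
    where
    open ≡-Reasoning
    degree-of-edge : ∀ e → ∑[ v < n ] indicator (Q? e ×-dec incident? e v) ≡ indicator (Q? e) + indicator (Q? e)
    degree-of-edge e with Q? e
    ... | yes _ = count-incident e
    ... | no _  = sum-replicate-zero n

  opposite : ∀ {v e} → Incident G v e → Fin n
  opposite {e = e} (inj₁ _) = proj₂ (edge G e)
  opposite {e = e} (inj₂ _) = proj₁ (edge G e)

  opposite-joins : ∀ {v e} (v∈e : Incident G v e) → SamePair (edge G e) (v , opposite v∈e)
  opposite-joins (inj₁ p) = inj₁ (p , refl)
  opposite-joins (inj₂ q) = inj₂ (refl , q)

  joins⇒incident : ∀ {v u e} → SamePair (edge G e) (v , u) → Incident G v e
  joins⇒incident (inj₁ (p , _)) = inj₁ p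
  joins⇒incident (inj₂ (_ , q)) = inj₂ q

record PerfectMatching {n m} (G : Graph n m) : Set where
  field
    partner            : Fin n → Fin n
    partner-involutive : ∀ v → partner (partner v) ≡ v
    partner-≢          : ∀ v → partner v ≢ v
    partner-adjacent   : ∀ v → Adj G v (partner v)

module EdgeSetMatching {n m} (G : Graph n m) {p} {M : Pred (Fin m) p}
  (covers : ∀ v → ∃[ e ] M e × Incident G v e)
  (unique : ∀ {v e e'} → M e → M e' → Incident G v e → Incident G v e' → e ≡ e') where

  matched : Fin n → Fin m
  matched v = proj₁ (covers v)

  matched-∈ : ∀ v → M (matched v)
  matched-∈ v = proj₁ (proj₂ (covers v))

  partner : Fin n → Fin n
  partner v = opposite G (proj₂ (proj₂ (covers v)))

  matched-joins : ∀ v → SamePair (edge G (matched v)) (v , partner v)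
  matched-joins v = opposite-joins G (proj₂ (proj₂ (covers v)))

  partner-involutive : ∀ v → partner (partner v) ≡ v
  partner-involutive v =
    SamePair-injectiveʳ (subst (λ e → SamePair (edge G e) (u , partner u)) same (matched-joins u)) u⋯v
    where
    u = partner v
    u⋯v : SamePair (edge G (matched v)) (u , v)
    u⋯v = SamePair-swapʳ (matched-joins v)
    same : matched u ≡ matched v
    same = unique (matched-∈ u) (matched-∈ v) (joins⇒incident G (matched-joins u)) (joins⇒incident G u⋯v)

  perfectMatching : PerfectMatching G
  perfectMatching = record
    { partner            = partner
    ; partner-involutive = partner-involutive
    ; partner-≢          = λ v u≡v → loopless G (matched v) (SamePair-diagonal
                             (subst (λ u → SamePair (edge G (matched v)) (v , u)) u≡v (matched-joins v)))
    ; partner-adjacent   = λ v → matched v , matched-joins v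
    }

module AlternatingWalk {n m} {G : Graph n m} (M : Bool → PerfectMatching G)
  (disjoint : ∀ v → PerfectMatching.partner (M true) v ≢ PerfectMatching.partner (M false) v) where

  open PerfectMatching

  partnerOf : Bool → Fin n → Fin n
  partnerOf b = partner (M b)

  partnerOf-injective : ∀ b {u v} → partnerOf b u ≡ partnerOf b v → u ≡ v
  partnerOf-injective b {u} {v} eq =
    trans (sym (partner-involutive (M b) u)) (trans (cong (partnerOf b) eq) (partner-involutive (M b) v))

  isEven : ℕ → Bool
  isEven zero    = true
  isEven (suc t) = not (isEven t)

  isEven-even+ : ∀ d t → isEven (d * 2 + t) ≡ isEven t
  isEven-even+ zero    t = refl
  isEven-even+ (suc d) t = trans (not-involutive _) (isEven-even+ d t)

  walk : Fin n → ℕ → Fin n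
  walk x zero    = x
  walk x (suc t) = partnerOf (isEven t) (walk x t)

  walk-odd-gap : ∀ x d i → walk x i ≢ walk x (suc (d * 2) + i)
  walk-odd-gap x zero    i eq = partner-≢ (M (isEven i)) (walk x i) (sym eq)
  walk-odd-gap x (suc d) i eq = walk-odd-gap x d (suc i) (begin
    partnerOf (isEven i) (walk x i)
      ≡⟨ cong (partnerOf (isEven i)) eq ⟩
    partnerOf (isEven i) (partnerOf (isEven (suc d * 2 + i)) w)
      ≡⟨ cong (λ b → partnerOf (isEven i) (partnerOf b w)) (isEven-even+ (suc d) i) ⟩
    partnerOf (isEven i) (partnerOf (isEven i) w)
      ≡⟨ partner-involutive (M (isEven i)) w ⟩
    w
      ≡⟨ cong (λ t → walk x (suc t)) (sym (+-suc (d * 2) i)) ⟩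
    walk x (suc (d * 2) + suc i) ∎)
    where
    open ≡-Reasoning
    w = walk x (suc (suc (d * 2 + i)))

  walk-even-gap : ∀ x d i → walk x i ≡ walk x (d * 2 + i) → x ≡ walk x (d * 2)
  walk-even-gap x d zero    eq = trans eq (cong (walk x) (+-identityʳ (d * 2)))
  walk-even-gap x d (suc i) eq = walk-even-gap x d i (partnerOf-injective (isEven i) (begin
    walk x (suc i)
      ≡⟨ eq ⟩
    walk x (d * 2 + suc i)
      ≡⟨ cong (walk x) (+-suc (d * 2) i) ⟩
    partnerOf (isEven (d * 2 + i)) (walk x (d * 2 + i))
      ≡⟨ cong (λ b → partnerOf b (walk x (d * 2 + i))) (isEven-even+ d i) ⟩
    partnerOf (isEven i) (walk x (d * 2 + i)) ∎))
    where open ≡-Reasoning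

  walk-repeat : ∀ x i δ → walk x i ≡ walk x (δ + i) → ∃[ d ] δ ≡ d * 2 × x ≡ walk x δ
  walk-repeat x i δ eq with even⊎odd δ
  ... | d , inj₁ refl = d , refl , walk-even-gap x d i eq
  ... | d , inj₂ refl = ⊥-elim (walk-odd-gap x d i eq)

  walk-repeat⇒return : ∀ x {a b} → a < b → walk x a ≡ walk x b → ∃[ t ] t < b × walk x (suc t) ≡ x
  walk-repeat⇒return x {a} {b} a<b eq with b ∸ a | m<n⇒0<n∸m a<b | m∸n+n≡m (<⇒≤ a<b)
  ... | suc t | _ | t+a≡b with _ , _ , x≡ ← walk-repeat x a (suc t) (trans eq (cong (walk x) (sym t+a≡b)))
    = t , ≤-trans (m≤m+n (suc t) a) (≤-reflexive t+a≡b) , sym x≡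

  Reach : Fin n → Fin n → Set
  Reach x y = ∃[ t ] walk x t ≡ y

  module Period (x : Fin n) where

    Returns : Fin n → Set
    Returns t = walk x (suc (toℕ t)) ≡ x

    returns : ∃ Returns
    returns with i , j , i<j , eq ← Finₚ.pigeonhole (n<1+n n) (λ t → walk x (toℕ t))
      with t , t<j , ret ← walk-repeat⇒return x i<j eq
      = fromℕ< t<n , subst (λ s → walk x (suc s) ≡ x) (sym (Finₚ.toℕ-fromℕ< t<n)) ret
      where
      t<n : t < n
      t<n = <-≤-trans t<j (≤-pred (Finₚ.toℕ<n j))

    -- Opaque, so that type checking never unfolds the pigeonhole search.
    opaque
      least-return : ∃[ u ] Returns u × (∀ {y} → Returns y → toℕ u ≤ toℕ y)
      least-return = ∃⟶∃-least (λ t → walk x (suc (toℕ t)) ≟ x) returns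

    last : ℕ
    last = toℕ (proj₁ least-return)

    walk-last : walk x (suc last) ≡ x
    walk-last = proj₁ (proj₂ least-return)

    no-early-return : ∀ {s} → s < last → walk x (suc s) ≢ x
    no-early-return {s} s<last ret = <⇒≱ s<last last≤s
      where
      s<n : s < n
      s<n = <-trans s<last (Finₚ.toℕ<n (proj₁ least-return))
      last≤s : last ≤ s
      last≤s = subst (last ≤_) (Finₚ.toℕ-fromℕ< s<n) (proj₂ (proj₂ least-return)
                 (subst (λ r → walk x (suc r) ≡ x) (sym (Finₚ.toℕ-fromℕ< s<n)) ret))

    length-even : ∃[ d ] suc last ≡ d * 2
    length-even with d , len≡ , _ ← walk-repeat x 0 (suc last)
                                       (sym (trans (cong (walk x) (+-identityʳ (suc last))) walk-last))
      = d , len≡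

    isEven-last : isEven last ≡ false
    isEven-last with d , len≡ ← length-even = begin
      isEven last                    ≡⟨ sym (not-involutive _) ⟩
      not (isEven (suc last))        ≡⟨ cong (λ t → not (isEven t)) (trans len≡ (sym (+-identityʳ _))) ⟩
      not (isEven (d * 2 + 0))       ≡⟨ cong not (isEven-even+ d 0) ⟩
      false                          ∎
      where open ≡-Reasoning

    2≤last : 2 ≤ last
    2≤last with last | walk-last
    ... | zero        | ret = ⊥-elim (partner-≢ (M true) x ret)
    ... | suc zero    | ret =
      ⊥-elim (disjoint x (trans (sym (partner-involutive (M false) _)) (cong (partnerOf false) ret)))
    ... | suc (suc _) | _   = s≤s (s≤s z≤n)

    walk-distinct : ∀ {a b} → a < b → b ≤ last → walk x a ≢ walk x b
    walk-distinct a<b b≤last eq with t , t<b , ret ← walk-repeat⇒return x a<b eq =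
      no-early-return (<-≤-trans t<b b≤last) ret

    vertex : Fin (suc last) → Fin n
    vertex i = walk x (toℕ i)

    vertex-injective : ∀ {i j} → vertex i ≡ vertex j → i ≡ j
    vertex-injective {i} {j} eq with <-cmp (toℕ i) (toℕ j)
    ... | tri< i<j _ _ = ⊥-elim (walk-distinct i<j (≤-pred (Finₚ.toℕ<n j)) eq)
    ... | tri≈ _ i≡j _ = Finₚ.toℕ-injective i≡j
    ... | tri> _ _ j<i = ⊥-elim (walk-distinct j<i (≤-pred (Finₚ.toℕ<n i)) (sym eq))

    cycle : Cycle G
    cycle = record
      { k     = last
      ; long  = 2≤last
      ; vert  = vertex
      ; inj   = vertex-injective
      ; step  = λ i → subst (λ t → Adj G (walk x t) (walk x (suc (toℕ i)))) (sym (Finₚ.toℕ-inject₁ i))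
                        (partner-adjacent (M (isEven (toℕ i))) (walk x (toℕ i)))
      ; close = subst₂ (λ t y → Adj G (walk x t) y) (sym (Finₚ.toℕ-fromℕ last)) walk-last
                        (partner-adjacent (M (isEven last)) (walk x last))
      }

    walk-within-period : ∀ t → ∃[ a ] a ≤ last × walk x a ≡ walk x t × isEven a ≡ isEven t
    walk-within-period zero = 0 , z≤n , refl , refl
    walk-within-period (suc t) with a , a≤last , wa≡wt , ea≡et ← walk-within-period t =
      wrap (m≤n⇒m<n∨m≡n a≤last) (cong₂ partnerOf ea≡et wa≡wt) (cong not ea≡et)
      where
      wrap : a < last ⊎ a ≡ last → walk x (suc a) ≡ walk x (suc t) → isEven (suc a) ≡ isEven (suc t) →
             ∃[ a' ] a' ≤ last × walk x a' ≡ walk x (suc t) × isEven a' ≡ isEven (suc t)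
      wrap (inj₁ a<last) w e = suc a , a<last , w , e
      wrap (inj₂ refl)   w e = 0 , z≤n , trans (sym walk-last) w , trans (sym (cong not isEven-last)) e

    reach⇒onCycle : ∀ {y} → Reach x y → OnCycle y cycle
    reach⇒onCycle (t , refl) with a , a≤last , wa≡wt , _ ← walk-within-period t =
      fromℕ< (s≤s a≤last) , trans (cong (walk x) (Finₚ.toℕ-fromℕ< (s≤s a≤last))) wa≡wt

    -- Unless it continues the walk, a step goes back along it (from x, back to its last vertex).
    reach-partner : ∀ b {y} → Reach x y → Reach x (partnerOf b y)
    reach-partner b (t , refl) with b ≟ᵇ isEven t
    ... | yes refl = suc t , refl
    reach-partner true  (zero , refl) | no b≢ = ⊥-elim (b≢ refl)
    reach-partner false (zero , refl) | no _  =
      last , trans (sym (partner-involutive (M false) (walk x last))) (cong (partnerOf false)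
                   (trans (cong (λ b → partnerOf b (walk x last)) (sym isEven-last)) walk-last))
    reach-partner b (suc s , refl) | no b≢ =
      s , sym (trans (cong (λ b → partnerOf b (walk x (suc s))) (trans (¬-not b≢) (not-involutive _)))
                     (partner-involutive (M (isEven s)) (walk x s)))

  onCycle⇒reach : ∀ {x y} → OnCycle y (Period.cycle x) → Reach x y
  onCycle⇒reach (i , eq) = toℕ i , eq

  reach-trans : ∀ {x y z} → Reach x y → Reach y z → Reach x z
  reach-trans {x} x⇝y (zero  , refl) = x⇝y
  reach-trans {x} x⇝y (suc t , refl) = Period.reach-partner x (isEven t) (reach-trans x⇝y (t , refl))

  reach-sym : ∀ {x y} → Reach x y → Reach y x
  reach-sym {x} (zero  , refl) = 0 , refl
  reach-sym {x} (suc t , refl) = reach-trans back (reach-sym (t , refl))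
    where
    back : Reach (walk x (suc t)) (walk x t)
    back = subst (Reach (walk x (suc t))) (partner-involutive (M (isEven t)) (walk x t))
                 (Period.reach-partner (walk x (suc t)) (isEven t) (0 , refl))

module CycleFactor {n m} {G : Graph n m} (cycleOf : Fin n → Cycle G)
  (starts   : ∀ x → vert (cycleOf x) zero ≡ x)
  (on-sym   : ∀ {x y} → OnCycle y (cycleOf x) → OnCycle x (cycleOf y))
  (on-trans : ∀ {x y z} → OnCycle y (cycleOf x) → OnCycle z (cycleOf y) → OnCycle z (cycleOf x)) where

  IsLeast : Fin n → Set
  IsLeast u = ∀ {y} → OnCycle y (cycleOf u) → toℕ u ≤ toℕ y

  isLeast? : Decidable IsLeast
  isLeast? u = map′ (λ u≤ → λ { (i , refl) → u≤ i }) (λ u≤ i → u≤ (i , refl))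
                    (Finₚ.all? (λ i → toℕ u ≤? toℕ (vert (cycleOf u) i)))

  least : ∀ v → ∃[ u ] OnCycle u (cycleOf v) × IsLeast u
  least v with u , v⋯u , minimal ← ∃⟶∃-least (λ y → Finₚ.any? (λ i → vert (cycleOf v) i ≟ y))
                                                (v , zero , starts v)
    = u , v⋯u , λ u⋯y → minimal (on-trans v⋯u u⋯y)

  least-unique : ∀ {u u' v} → IsLeast u → IsLeast u' → OnCycle v (cycleOf u) → OnCycle v (cycleOf u') → u ≡ u'
  least-unique u-least u'-least u⋯v u'⋯v = Finₚ.toℕ-injective (≤-antisym
    (u-least (on-trans u⋯v (on-sym u'⋯v))) (u'-least (on-trans u'⋯v (on-sym u⋯v))))

  cycles : List (Cycle G)
  cycles = map cycleOf (filter isLeast? (allFin n))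

  cycles-unique : Unique cycles
  cycles-unique = Uniqueₚ.map⁺ cycleOf-injective (Uniqueₚ.filter⁺ isLeast? (Uniqueₚ.allFin⁺ n))
    where
    cycleOf-injective : ∀ {x y} → cycleOf x ≡ cycleOf y → x ≡ y
    cycleOf-injective {x} {y} eq = trans (sym (starts x)) (trans (cong (λ C → vert C zero) eq) (starts y))

  cycle-at : ∀ i → ∃[ u ] IsLeast u × lookup cycles i ≡ cycleOf u
  cycle-at i with u , u∈ , eq ← ∈-map⁻ cycleOf (∈-lookup {xs = cycles} i) =
    u , proj₂ (∈-filter⁻ isLeast? {xs = allFin n} u∈) , eq

  cycles-2Factor : Is2Factor G cycles
  cycles-2Factor v with u , v⋯u , u-least ← least v =
    (index u∈ , subst (OnCycle v) (lookup-index u∈) (on-sym v⋯u)) , unique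
    where
    u∈ : cycleOf u ∈ cycles
    u∈ = ∈-map⁺ cycleOf (∈-filter⁺ isLeast? (∈-allFin u) u-least)
    unique : ∀ i j → OnCycle v (lookup cycles i) → OnCycle v (lookup cycles j) → i ≡ j
    unique i j on-i on-j with w , w-least , i≡ ← cycle-at i | w' , w'-least , j≡ ← cycle-at j =
      Unique⇒lookup-injective cycles-unique i j (trans i≡ (trans
        (cong cycleOf (least-unique w-least w'-least (subst (OnCycle v) i≡ on-i) (subst (OnCycle v) j≡ on-j)))
        (sym j≡)))

evenCycleFactor : ∀ {n m} {G : Graph n m} (M : Bool → PerfectMatching G) →
                  (∀ v → PerfectMatching.partner (M true) v ≢ PerfectMatching.partner (M false) v) →
                  HasEvenCycleFactor G
evenCycleFactor M disjoint = cycles , cycles-2Factor , cycles-even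
  where
  open AlternatingWalk M disjoint
  open CycleFactor Period.cycle (λ _ → refl)
    (λ {x} {y} x⋯y → Period.reach⇒onCycle y (reach-sym (onCycle⇒reach x⋯y)))
    (λ {x} x⋯y y⋯z → Period.reach⇒onCycle x (reach-trans (onCycle⇒reach x⋯y) (onCycle⇒reach y⋯z)))
  cycles-even : ∀ i → 2 ∣ length-of (lookup cycles i)
  cycles-even i with u , _ , eq ← cycle-at i with d , len≡ ← Period.length-even u =
    subst (λ C → 2 ∣ length-of C) (sym eq) (divides d len≡)

module ProperColouring {n m} (G : Graph n m) (S : Subset m) (c : Fin m → Bool)
  (proper : ∀ e f → e ∉ S → f ∉ S → LineAdj G e f → c e ≢ c f) where

  ColourClass : Bool → Fin m → Set
  ColourClass b e = e ∉ S × c e ≡ b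

  colourClass? : ∀ b → Decidable (ColourClass b)
  colourClass? b e = ¬? (e ∈? S) ×-dec c e ≟ᵇ b

  colourClass-unique : ∀ {b v e e'} → ColourClass b e → ColourClass b e' →
                       Incident G v e → Incident G v e' → e ≡ e'
  colourClass-unique {v = v} {e} {e'} (e∉S , ce≡b) (e'∉S , ce'≡b) v∈e v∈e' with e ≟ e'
  ... | yes e≡e' = e≡e'
  ... | no  e≢e' = ⊥-elim (proper e e' e∉S e'∉S (e≢e' , v , v∈e , v∈e') (trans ce≡b (sym ce'≡b)))

  degree : Bool → Fin n → ℕ
  degree b v = count (λ e → colourClass? b e ×-dec incident? G e v)

  degree≤1 : ∀ b v → degree b v ≤ 1
  degree≤1 b v = count≤1 (λ e → colourClass? b e ×-dec incident? G e v)
    λ (Ce , v∈e) (Ce' , v∈e') → colourClass-unique Ce Ce' v∈e v∈e'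

  outside : ℕ
  outside = count (λ e → ¬? (e ∈? S))

  ∑-degree : ∑[ v < n ] (degree true v + degree false v) ≡ outside + outside
  ∑-degree = trans (sum-cong-≗ degree-by-colour) (handshake G (λ e → ¬? (e ∈? S)))
    where
    degree-by-colour : ∀ v → degree true v + degree false v ≡ count (λ e → ¬? (e ∈? S) ×-dec incident? G e v)
    degree-by-colour v = trans
      (sym (∑-distrib-+ (λ e → indicator (colourClass? true e ×-dec incident? G e v))
                        (λ e → indicator (colourClass? false e ×-dec incident? G e v))))
      (sum-cong-≗ λ e → indicator-by-colour (¬? (e ∈? S)) (c e) (incident? G e v))

  module _ (large : ∣ S ∣ + n ≤ m) where

    n≤outside : n ≤ outside
    n≤outside = +-cancelˡ-≤ ∣ S ∣ n outside
      (subst (∣ S ∣ + n ≤_) (trans (sym (count-∉ S)) (+-comm outside ∣ S ∣)) large)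

    2≤degree : ∀ v → 2 ≤ degree true v + degree false v
    2≤degree = ∑-mono-≤-tight (λ v → +-mono-≤ (degree≤1 true v) (degree≤1 false v)) (begin
      ∑[ v < n ] 2                        ≡⟨ ∑-distrib-+ {n} (λ _ → 1) (λ _ → 1) ⟩
      ∑[ v < n ] 1 + ∑[ v < n ] 1         ≡⟨ cong₂ _+_ ones ones ⟩
      n + n                               ≤⟨ +-mono-≤ n≤outside n≤outside ⟩
      outside + outside                   ≡⟨ sym ∑-degree ⟩
      ∑[ v < n ] (degree true v + degree false v) ∎)
      where
      open ≤-Reasoning
      ones : ∑[ v < n ] 1 ≡ n
      ones = trans (∑-const n 1) (*-identityʳ n)

    1≤degree : ∀ b v → 1 ≤ degree b v
    1≤degree true  v = +-cancelʳ-≤ 1 1 _ (≤-trans (2≤degree v) (+-monoʳ-≤ _ (degree≤1 false v)))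
    1≤degree false v = +-cancelʳ-≤ 1 1 _
      (≤-trans (2≤degree v) (≤-trans (+-monoˡ-≤ _ (degree≤1 true v)) (≤-reflexive (+-comm 1 _))))

    colourClass-covers : ∀ b v → ∃[ e ] ColourClass b e × Incident G v e
    colourClass-covers b v = count-witness (λ e → colourClass? b e ×-dec incident? G e v) (1≤degree b v)

    module Colour b = EdgeSetMatching G (colourClass-covers b) colourClass-unique

    colourMatching : Bool → PerfectMatching G
    colourMatching b = Colour.perfectMatching b

    colourMatchings-disjoint : ∀ v → Colour.partner true v ≢ Colour.partner false v
    colourMatchings-disjoint v same-partner = case colours-agree of λ ()
      where
      same-edge : Colour.matched true v ≡ Colour.matched false v
      same-edge = simple G _ _ (SamePair-trans (Colour.matched-joins true v) (SamePair-sym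
        (subst (λ u → SamePair (edge G (Colour.matched false v)) (v , u)) (sym same-partner)
               (Colour.matched-joins false v))))
      colours-agree : true ≡ false
      colours-agree = trans (sym (proj₂ (Colour.matched-∈ true v)))
                            (trans (cong c same-edge) (proj₂ (Colour.matched-∈ false v)))

lemma2 : ∀ (n m : ℕ) (G : Graph n m) (S : Subset m) →
    IsOCT G S → ∣ S ∣ + n ≤ m → HasEvenCycleFactor G
lemma2 n m G S (c , proper) large = evenCycleFactor (colourMatching large) (colourMatchings-disjoint large)
  where open ProperColouring G S c proper
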